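{- Let $G$ be a rotor graph and $(\rho,\sigma)$ a rotor-particle configuration with $\sigma\ge0$. If $(\rho',\sigma')=\mathrm{routing}^\infty_L(\rho,\sigma)$ and $(\rho_1,\sigma_1)\in\mathrm{routing}^\infty(\rho,\sigma)$, then $\sigma_1=\sigma'$ and $\rho'\sim\rho_1$.
   Context: A rotor graph is a stopping directed multigraph $G=(V,A,\mathrm{head},\mathrm{tail})$ (every vertex has a directed path to a sink, i.e. a vertex of outdegree $0$) with a rotor order: a bijection $\theta:A\to A$ which, for each vertex $u$ in the set $V_0$ of non-sink vertices, permutes the set $A^+(u)$ of arcs out of $u$ as a single cycle. A rotor configuration is a map $\rho:V_0\to A$ with $\rho(u)\in A^+(u)$; a particle configuration is a map $\sigma:V\to\mathbb{Z}$ (a vertex $u$ is identified with the configuration with one particle on $u$). For $u\in V_0$, $\mathrm{routing}^+_u(\rho,\sigma)=(\rho',\sigma+\mathrm{head}(\rho(u))-u)$ where $\rho'$ equals $\rho$ except $\rho'(u)=\theta(\rho(u))$; these are commuting bijections; for $r:V_0\to\mathbb{Z}$, $\mathrm{routing}^r$ composes the $(\mathrm{routing}^+_u)^{r(u)}$ (negative powers = inverses). $(\rho,\sigma)\sim(\rho',\sigma')$ iff $\mathrm{routing}^r(\rho,\sigma)=(\rho',\sigma')$ for some $r$; $\rho\sim\rho'$ iff $(\rho,\sigma)\sim(\rho',\sigma)$ for some $\sigma$. $\mathrm{routing}^\infty(\rho,\sigma)$ is the set of $(\rho',\sigma')\sim(\rho,\sigma)$ with $\sigma'(u)=0$ for all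 $u\in V_0$. Applying $\mathrm{routing}^+_u$ to $(\rho,\sigma)$ is a legal routing if $\sigma(u)>0$; a sequence of legal routings is maximal if it ends in a configuration with $\sigma(u)\le0$ for all $u\in V_0$. For $\sigma\ge0$ it is known that all maximal legal routing sequences from $(\rho,\sigma)$ end in the same configuration $(\rho',\sigma')$, which satisfies $\sigma'(u)=0$ for all $u\in V_0$; this configuration is denoted $\mathrm{routing}^\infty_L(\rho,\sigma)$. -}

module Defs where

open import Data.Nat as ℕ using (ℕ; zero; suc)
open import Data.Integer as ℤ using (ℤ; +_; -[1+_]; 0ℤ; 1ℤ)
open import Data.Fin using (Fin; _≟_)
open import Data.Fin.Properties using (any?)
open import Data.Bool using (Bool; T; if_then_else_)
open import Data.List using (List; foldr; allFin)
open import Data.Product using (Σ; ∃; ∃-syntax; _×_; _,_; proj₁; proj₂)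
open import Data.Empty using (⊥)
open import Function using (_∘_; id)
open import Relation.Nullary using (¬_; yes; no)
open import Relation.Nullary.Decidable using (⌊_⌋; T?)
open import Relation.Binary.PropositionalEquality using (_≡_; _≢_)
open import Relation.Binary.Construct.Closure.ReflexiveTransitive using (Star)

iter : ∀ {A : Set} → (A → A) → ℕ → A → A
iter f zero    = id
iter f (suc k) = f ∘ iter f k

record RotorGraph : Set where
  field
    n m      : ℕ
    head tail : Fin m → Fin n
    θ θ⁻     : Fin m → Fin m
    θ⁻θ      : ∀ a → θ⁻ (θ a) ≡ a
    θθ⁻      : ∀ a → θ (θ⁻ a) ≡ a
    θ-tail   : ∀ a → tail (θ a) ≡ tail a
    θ-cycle  : ∀ a b → tail a ≡ tail b → ∃[ k ] iter θ k a ≡ b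

  Edge : Fin n → Fin n → Set
  Edge u v = ∃[ a ] (tail a ≡ u × head a ≡ v)

  Sink : Fin n → Set
  Sink u = ∀ a → tail a ≢ u

  field
    stopping : ∀ u → ∃[ v ] (Star Edge u v × Sink v)

  isNonSink : Fin n → Bool
  isNonSink u = ⌊ any? (λ a → tail a ≟ u) ⌋

  V₀ : Fin n → Set
  V₀ u = T (isNonSink u)

module _ (G : RotorGraph) where
  open RotorGraph G

  Rotor : Set
  Rotor = (u : Fin n) → V₀ u → Fin m

  ValidRotor : Rotor → Set
  ValidRotor ρ = ∀ u (p : V₀ u) → tail (ρ u p) ≡ u

  Particles : Set
  Particles = Fin n → ℤ

  Config : Set
  Config = Rotor × Particles

  δ : Fin n → Particles
  δ w v = if ⌊ v ≟ w ⌋ then 1ℤ else 0ℤ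

  updRotor : Rotor → Fin n → Fin m → Rotor
  updRotor ρ u a v p = if ⌊ v ≟ u ⌋ then a else ρ v p

  routing⁺ : (u : Fin n) → V₀ u → Config → Config
  routing⁺ u p (ρ , σ) =
    updRotor ρ u (θ (ρ u p)) , (λ v → (σ v ℤ.+ δ (head (ρ u p)) v) ℤ.- δ u v)

  routing⁻ : (u : Fin n) → V₀ u → Config → Config
  routing⁻ u p (ρ , σ) =
    updRotor ρ u (θ⁻ (ρ u p)) , (λ v → (σ v ℤ.- δ (head (θ⁻ (ρ u p))) v) ℤ.+ δ u v)

  routingPow : (u : Fin n) → V₀ u → ℤ → Config → Config
  routingPow u p (+ k)    = iter (routing⁺ u p) k
  routingPow u p -[1+ k ] = iter (routing⁻ u p) (suc k)

  routingStep : ((u : Fin n) → V₀ u → ℤ) → Fin n → Config → Config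
  routingStep r u c with T? (isNonSink u)
  ... | yes p = routingPow u p (r u p) c
  ... | no _  = c

  routing : ((u : Fin n) → V₀ u → ℤ) → Config → Config
  routing r c = foldr (routingStep r) c (allFin n)

  RotorEq : Rotor → Rotor → Set
  RotorEq ρ ρ' = ∀ u (p : V₀ u) → ρ u p ≡ ρ' u p

  ConfigEq : Config → Config → Set
  ConfigEq (ρ , σ) (ρ' , σ') = RotorEq ρ ρ' × (∀ v → σ v ≡ σ' v)

  _∼_ : Config → Config → Set
  c ∼ c' = ∃[ r ] ConfigEq (routing r c) c'

  _∼ᵣ_ : Rotor → Rotor → Set
  ρ ∼ᵣ ρ' = ∃[ σ ] ((ρ , σ) ∼ (ρ' , σ))

  _∈routing∞_ : Config → Config → Set
  (ρ' , σ') ∈routing∞ c = (c ∼ (ρ' , σ')) × (∀ u → V₀ u → σ' u ≡ 0ℤ)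

  LegalStep : Config → Config → Set
  LegalStep (ρ , σ) c' = Σ (Fin n) λ u → Σ (V₀ u) λ p →
    (ℤ.0ℤ ℤ.< σ u) × (c' ≡ routing⁺ u p (ρ , σ))

  Stable : Config → Set
  Stable (ρ , σ) = ∀ u → V₀ u → σ u ℤ.≤ 0ℤ

  IsRoutingInfL : Config → Config → Set
  IsRoutingInfL c c' = Star LegalStep c c' × Stable c'

-- The result of routing (ρ, σ) depends only on the firing vector K : V → ℤ
-- (how often each vertex is routed): the rotor at u becomes θ^(K u) (ρ u) and
-- σ gains the net flow of K.  A maximal legal routing and any element of
-- routing^∞ are both of this form, with every non-sink emptied.  Two firing
-- vectors K₁, K₂ that produce the same net flow wherever they differ produce
-- the same net flow everywhere: on S = {K₂ < K₁} the extra firings of S send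
-- at least as many particles into S as S gains, and by balance no more, so
-- none of them leaves S.  Sinks never fire, so they lie outside S and its
-- mirror image and receive the same particles in both routings.  The rotors
-- then differ by routing K₁ − K₂.

module Submission where

open import Defs
open import Data.Nat as ℕ using (ℕ; zero; suc)
open import Data.Integer as ℤ using (ℤ; +_; -[1+_]; 0ℤ; 1ℤ; -1ℤ; _+_; _-_; _*_; -_; _≤_; _<_)
import Data.Integer.Properties as ℤP
open import Data.Integer.Tactic.RingSolver using (solve-∀)
open import Algebra.Properties.AbelianGroup ℤP.+-0-abelianGroup using (∙-cancelˡ; ⁻¹-anti-homo‿-)
open import Algebra.Properties.CommutativeMonoid.Sum ℤP.+-0-commutativeMonoid
  using (sum; sum-cong-≗; ∑-distrib-+; ∑-comm; sum-remove; sum-replicate-zero)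
open import Data.Fin as Fin using (Fin; _≟_; punchIn)
open import Data.Fin.Properties using (punchInᵢ≢i)
open import Data.Bool using (Bool; true; false; if_then_else_)
open import Data.Bool.Properties using (T-irrelevant)
open import Data.Product using (∃-syntax; _×_; _,_; proj₁; proj₂)
open import Data.List using (foldr; tabulate)
open import Function using (_∘_; id)
open import Relation.Nullary using (¬_; yes; no; contradiction)
open import Relation.Nullary.Decidable using (⌊_⌋; T?)
open import Relation.Binary.PropositionalEquality
open import Relation.Binary.Construct.Closure.ReflexiveTransitive using (Star; ε; _◅_)
open import Relation.Binary.Definitions using (tri<; tri≈; tri>)

keepIf : Bool → ℤ → ℤ
keepIf b x = if b then x else 0ℤ

keepIf-zero : ∀ b → keepIf b 0ℤ ≡ 0ℤ
keepIf-zero true  = refl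
keepIf-zero false = refl

keepIf-+ : ∀ b x y → keepIf b (x + y) ≡ keepIf b x + keepIf b y
keepIf-+ true  x y = refl
keepIf-+ false x y = refl

keepIf-- : ∀ b x y → keepIf b (x - y) ≡ keepIf b x - keepIf b y
keepIf-- true  x y = refl
keepIf-- false x y = refl

keepIf-mono-≤ : ∀ b {x y} → x ≤ y → keepIf b x ≤ keepIf b y
keepIf-mono-≤ true  x≤y = x≤y
keepIf-mono-≤ false _   = ℤP.≤-refl

keepIf≤ : ∀ b {x} → 0ℤ ≤ x → keepIf b x ≤ x
keepIf≤ true  _   = ℤP.≤-refl
keepIf≤ false 0≤x = 0≤x

point : ∀ {k} → Fin k → ℤ → Fin k → ℤ
point w x v = keepIf ⌊ v ≟ w ⌋ x

point-at : ∀ {k} (w : Fin k) x → point w x w ≡ x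
point-at w x with w ≟ w
... | yes _   = refl
... | no w≢w = contradiction refl w≢w

point-off : ∀ {k} {w v : Fin k} x → v ≢ w → point w x v ≡ 0ℤ
point-off {w = w} {v} x v≢w with v ≟ w
... | yes v≡w = contradiction v≡w v≢w
... | no _    = refl

point-swap : ∀ {k} (x : Fin k → ℤ) u v → point u (x u) v ≡ point v (x v) u
point-swap x u v with v ≟ u
... | yes refl = sym (point-at u (x u))
... | no v≢u  = sym (point-off (x v) (v≢u ∘ sym))

addAt : ∀ {k} → Fin k → ℤ → (Fin k → ℤ) → Fin k → ℤ
addAt w d K u = point w d u + K u

addAt-zero : ∀ {k} (w : Fin k) K u → addAt w 0ℤ K u ≡ K u
addAt-zero w K u = trans (cong (_+ K u) (keepIf-zero ⌊ u ≟ w ⌋)) (ℤP.+-identityˡ (K u))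

addAt-addAt : ∀ {k} (w : Fin k) d e K u → addAt w d (addAt w e K) u ≡ addAt w (d + e) K u
addAt-addAt w d e K u =
  trans (sym (ℤP.+-assoc (point w d u) (point w e u) (K u))) (cong (_+ K u) (sym (keepIf-+ ⌊ u ≟ w ⌋ d e)))

∑-neg : ∀ {k} (f : Fin k → ℤ) → sum (λ i → - f i) ≡ - sum f
∑-neg {zero}  f = refl
∑-neg {suc k} f =
  trans (cong (_+_ (- f Fin.zero)) (∑-neg (f ∘ Fin.suc)))
        (sym (ℤP.neg-distrib-+ (f Fin.zero) (sum (f ∘ Fin.suc))))

∑-distrib-- : ∀ {k} (f g : Fin k → ℤ) → sum (λ i → f i - g i) ≡ sum f - sum g
∑-distrib-- f g = trans (∑-distrib-+ f (λ i → - g i)) (cong (_+_ (sum f)) (∑-neg g))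

∑-mono-≤ : ∀ {k} {f g : Fin k → ℤ} → (∀ i → f i ≤ g i) → sum f ≤ sum g
∑-mono-≤ {zero}  _   = ℤP.≤-refl
∑-mono-≤ {suc k} f≤g = ℤP.+-mono-≤ (f≤g Fin.zero) (∑-mono-≤ (f≤g ∘ Fin.suc))

≤∧∑≡∑⇒≗ : ∀ {k} {f g : Fin k → ℤ} → (∀ i → f i ≤ g i) → sum f ≡ sum g → ∀ i → f i ≡ g i
≤∧∑≡∑⇒≗ {suc k} {f} {g} f≤g ∑f≡∑g = pointwise
  where
  head≡ : f Fin.zero ≡ g Fin.zero
  head≡ = ℤP.≤∧≮⇒≡ (f≤g Fin.zero)
    (λ f₀<g₀ → ℤP.<⇒≢ (ℤP.+-mono-<-≤ f₀<g₀ (∑-mono-≤ (f≤g ∘ Fin.suc))) ∑f≡∑g)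
  pointwise : ∀ i → f i ≡ g i
  pointwise Fin.zero    = head≡
  pointwise (Fin.suc i) = ≤∧∑≡∑⇒≗ (f≤g ∘ Fin.suc)
    (∙-cancelˡ (f Fin.zero) _ _ (trans ∑f≡∑g (cong (_+ sum (g ∘ Fin.suc)) (sym head≡)))) i

∑-keepIf : ∀ {k} b (f : Fin k → ℤ) → sum (λ i → keepIf b (f i)) ≡ keepIf b (sum f)
∑-keepIf true  f     = refl
∑-keepIf {k} false f = sum-replicate-zero k

∑-update : ∀ {k} {f f' : Fin k → ℤ} w → (∀ u → u ≢ w → f' u ≡ f u) → sum f' ≡ sum f + (f' w - f w)
∑-update {suc k} {f} {f'} w agree = begin
    sum f'                                      ≡⟨ sum-remove {i = w} f' ⟩
    f' w + sum (f' ∘ punchIn w)                 ≡⟨ cong (_+_ (f' w)) (sum-cong-≗ (agree _ ∘ punchInᵢ≢i w)) ⟩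
    f' w + sum (f ∘ punchIn w)                  ≡⟨ regroup (f' w) (f w) (sum (f ∘ punchIn w)) ⟩
    (f w + sum (f ∘ punchIn w)) + (f' w - f w)  ≡⟨ cong (_+ (f' w - f w)) (sym (sum-remove {i = w} f)) ⟩
    sum f + (f' w - f w)                        ∎
  where
  open ≡-Reasoning
  regroup : ∀ a b s → a + s ≡ (b + s) + (a - b)
  regroup = solve-∀

∑-point : ∀ {k} (w : Fin k) x → sum (point w x) ≡ x
∑-point {suc k} w x = begin
    sum (point w x)                            ≡⟨ sum-remove {i = w} (point w x) ⟩
    point w x w + sum (point w x ∘ punchIn w)  ≡⟨ cong₂ _+_ (point-at w x) elsewhere ⟩
    x + 0ℤ                                     ≡⟨ ℤP.+-identityʳ x ⟩
    x                                          ∎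
  where
  open ≡-Reasoning
  elsewhere : sum (point w x ∘ punchIn w) ≡ 0ℤ
  elsewhere = trans (sum-cong-≗ (λ j → point-off x (punchInᵢ≢i w j))) (sum-replicate-zero k)

∑-point-diag : ∀ {k} (x : Fin k → ℤ) v → sum (λ u → point u (x u) v) ≡ x v
∑-point-diag x v = trans (sum-cong-≗ (λ u → point-swap x u v)) (∑-point v (x v))

ℤ-induction : (P : ℤ → Set) → P 0ℤ →
  (∀ k → P k → P (ℤ.suc k)) → (∀ k → P (ℤ.suc k) → P k) → ∀ k → P k
ℤ-induction P base up down (+ zero)      = base
ℤ-induction P base up down (+ suc k)     = up (+ k) (ℤ-induction P base up down (+ k))
ℤ-induction P base up down -[1+ zero ]   = down -[1+ zero ] base
ℤ-induction P base up down -[1+ suc k ]  = down -[1+ suc k ] (ℤ-induction P base up down -[1+ k ])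

suc-increasing⇒mono : (f : ℤ → ℤ) → (∀ k → f k ≤ f (ℤ.suc k)) → ∀ {i j} → i ≤ j → f i ≤ f j
suc-increasing⇒mono f step {i} {j} i≤j = subst (λ l → f i ≤ f l) j-i+i≡j (up ℤ.∣ j - i ∣)
  where
  up : ∀ d → f i ≤ f (+ d + i)
  up zero    = ℤP.≤-reflexive (cong f (sym (ℤP.+-identityˡ i)))
  up (suc d) = ℤP.≤-trans (up d)
    (subst (λ l → f (+ d + i) ≤ f l) (sym (ℤP.+-assoc 1ℤ (+ d) i)) (step (+ d + i)))
  cancel : ∀ i j → j - i + i ≡ j
  cancel = solve-∀
  j-i+i≡j : + ℤ.∣ j - i ∣ + i ≡ j
  j-i+i≡j = trans (cong (_+ i) (ℤP.0≤i⇒+∣i∣≡i (ℤP.i≤j⇒0≤j-i i≤j))) (cancel i j)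

module FlowConservation {k : ℕ} (send : Fin k → ℤ → Fin k → ℤ)
  (send-mono : ∀ u {a b} → a ≤ b → ∀ v → send u a v ≤ send u b v)
  (∑-send : ∀ u a → sum (send u a) ≡ a) where

  effect : Fin k → ℤ → Fin k → ℤ
  effect u a v = send u a v - point u a v

  netFlow : (Fin k → ℤ) → Fin k → ℤ
  netFlow K v = sum (λ u → effect u (K u) v)

  transfer : (K₁ K₂ : Fin k → ℤ) → Fin k → Fin k → ℤ
  transfer K₁ K₂ u v = send u (K₁ u) v - send u (K₂ u) v

  ∑-transfer : ∀ K₁ K₂ u → sum (transfer K₁ K₂ u) ≡ K₁ u - K₂ u
  ∑-transfer K₁ K₂ u =
    trans (∑-distrib-- (send u (K₁ u)) (send u (K₂ u))) (cong₂ _-_ (∑-send u (K₁ u)) (∑-send u (K₂ u)))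

  netFlow-difference : ∀ K₁ K₂ v →
    netFlow K₁ v - netFlow K₂ v ≡ sum (λ u → transfer K₁ K₂ u v) - (K₁ v - K₂ v)
  netFlow-difference K₁ K₂ v = begin
      netFlow K₁ v - netFlow K₂ v
    ≡⟨ sym (∑-distrib-- (λ u → effect u (K₁ u) v) (λ u → effect u (K₂ u) v)) ⟩
      sum (λ u → effect u (K₁ u) v - effect u (K₂ u) v)
    ≡⟨ sum-cong-≗ (λ u → trans (regroup (send u (K₁ u) v) (point u (K₁ u) v) (send u (K₂ u) v) (point u (K₂ u) v))
                               (cong (_-_ (transfer K₁ K₂ u v)) (sym (keepIf-- _ (K₁ u) (K₂ u))))) ⟩
      sum (λ u → transfer K₁ K₂ u v - point u (K₁ u - K₂ u) v)
    ≡⟨ ∑-distrib-- (λ u → transfer K₁ K₂ u v) (λ u → point u (K₁ u - K₂ u) v) ⟩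
      sum (λ u → transfer K₁ K₂ u v) - sum (λ u → point u (K₁ u - K₂ u) v)
    ≡⟨ cong (_-_ (sum (λ u → transfer K₁ K₂ u v))) (∑-point-diag (λ u → K₁ u - K₂ u) v) ⟩
      sum (λ u → transfer K₁ K₂ u v) - (K₁ v - K₂ v)
    ∎
    where
    open ≡-Reasoning
    regroup : ∀ s₁ p₁ s₂ p₂ → (s₁ - p₁) - (s₂ - p₂) ≡ (s₁ - s₂) - (p₁ - p₂)
    regroup = solve-∀

  balance : ∀ K₁ K₂ v → netFlow K₁ v ≡ netFlow K₂ v → sum (λ u → transfer K₁ K₂ u v) ≡ K₁ v - K₂ v
  balance K₁ K₂ v eq =
    ℤP.i-j≡0⇒i≡j _ _ (trans (sym (netFlow-difference K₁ K₂ v)) (ℤP.i≡j⇒i-j≡0 eq))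

  module Surplus (K₁ K₂ : Fin k → ℤ)
    (balanced : ∀ v → K₂ v < K₁ v → netFlow K₁ v ≡ netFlow K₂ v) where

    surplus : Fin k → Bool
    surplus v = ⌊ K₂ v ℤP.<? K₁ v ⌋

    keepIf-surplus : ∀ {v} x → K₂ v < K₁ v → keepIf (surplus v) x ≡ x
    keepIf-surplus {v} x K₂<K₁ with K₂ v ℤP.<? K₁ v
    ... | yes _    = refl
    ... | no K₂≮K₁ = contradiction K₂<K₁ K₂≮K₁

    keepIf-nonsurplus : ∀ {v} x → ¬ K₂ v < K₁ v → keepIf (surplus v) x ≡ 0ℤ
    keepIf-nonsurplus {v} x K₂≮K₁ with K₂ v ℤP.<? K₁ v
    ... | yes K₂<K₁ = contradiction K₂<K₁ K₂≮K₁
    ... | no _      = refl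

    retained : Fin k → ℤ
    retained u = sum (λ v → keepIf (surplus v) (transfer K₁ K₂ u v))

    retained≤ : ∀ u → retained u ≤ keepIf (surplus u) (K₁ u - K₂ u)
    retained≤ u with K₂ u ℤP.<? K₁ u
    ... | yes K₂<K₁ = ℤP.≤-trans
            (∑-mono-≤ (λ v → keepIf≤ (surplus v) (ℤP.i≤j⇒0≤j-i (send-mono u (ℤP.<⇒≤ K₂<K₁) v))))
            (ℤP.≤-reflexive (∑-transfer K₁ K₂ u))
    ... | no K₂≮K₁ = ℤP.≤-trans
            (∑-mono-≤ (λ v → ℤP.≤-trans
              (keepIf-mono-≤ (surplus v) (ℤP.i≤j⇒i-j≤0 (send-mono u (ℤP.≮⇒≥ K₂≮K₁) v)))
              (ℤP.≤-reflexive (keepIf-zero (surplus v)))))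
            (ℤP.≤-reflexive (sum-replicate-zero k))

    ∑-retained : sum retained ≡ sum (λ u → keepIf (surplus u) (K₁ u - K₂ u))
    ∑-retained = begin
        sum retained
      ≡⟨ ∑-comm (λ u v → keepIf (surplus v) (transfer K₁ K₂ u v)) ⟩
        sum (λ v → sum (λ u → keepIf (surplus v) (transfer K₁ K₂ u v)))
      ≡⟨ sum-cong-≗ (λ v → trans (∑-keepIf (surplus v) (λ u → transfer K₁ K₂ u v)) (balanced-on v)) ⟩
        sum (λ v → keepIf (surplus v) (K₁ v - K₂ v))
      ∎
      where
      open ≡-Reasoning
      balanced-on : ∀ v →
        keepIf (surplus v) (sum (λ u → transfer K₁ K₂ u v)) ≡ keepIf (surplus v) (K₁ v - K₂ v)
      balanced-on v with K₂ v ℤP.<? K₁ v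
      ... | yes K₂<K₁ = balance K₁ K₂ v (balanced v K₂<K₁)
      ... | no _      = refl

    surplus-confined : ∀ u s → K₂ u < K₁ u → ¬ K₂ s < K₁ s → send u (K₁ u) s ≡ send u (K₂ u) s
    surplus-confined u s K₂<K₁ K₂≮K₁ =
      ℤP.i-j≡0⇒i≡j _ _ (trans (sym (all-retained s)) (keepIf-nonsurplus _ K₂≮K₁))
      where
      nonneg : ∀ v → 0ℤ ≤ transfer K₁ K₂ u v
      nonneg v = ℤP.i≤j⇒0≤j-i (send-mono u (ℤP.<⇒≤ K₂<K₁) v)
      retained≡ : retained u ≡ sum (transfer K₁ K₂ u)
      retained≡ = trans (≤∧∑≡∑⇒≗ retained≤ ∑-retained u)
                        (trans (keepIf-surplus _ K₂<K₁) (sym (∑-transfer K₁ K₂ u)))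
      all-retained : ∀ v → keepIf (surplus v) (transfer K₁ K₂ u v) ≡ transfer K₁ K₂ u v
      all-retained = ≤∧∑≡∑⇒≗ (λ v → keepIf≤ (surplus v) (nonneg v)) retained≡

  netFlow-unique : ∀ K₁ K₂ → (∀ v → K₁ v ≢ K₂ v → netFlow K₁ v ≡ netFlow K₂ v) →
    ∀ v → netFlow K₁ v ≡ netFlow K₂ v
  netFlow-unique K₁ K₂ differ v with K₁ v ℤ.≟ K₂ v
  ... | no K₁≢K₂ = differ v K₁≢K₂
  ... | yes K₁≡K₂ = ℤP.i-j≡0⇒i≡j _ _ (begin
      netFlow K₁ v - netFlow K₂ v
    ≡⟨ netFlow-difference K₁ K₂ v ⟩
      sum (λ u → transfer K₁ K₂ u v) - (K₁ v - K₂ v)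
    ≡⟨ cong₂ _-_ (trans (sum-cong-≗ no-transfer) (sum-replicate-zero k)) (ℤP.i≡j⇒i-j≡0 K₁≡K₂) ⟩
      0ℤ
    ∎)
    where
    open ≡-Reasoning
    open Surplus K₁ K₂ (λ w K₂<K₁ → differ w (ℤP.<⇒≢ K₂<K₁ ∘ sym)) using (surplus-confined)
    module Mirror = Surplus K₂ K₁ (λ w K₁<K₂ → sym (differ w (ℤP.<⇒≢ K₁<K₂)))
    no-transfer : ∀ u → transfer K₁ K₂ u v ≡ 0ℤ
    no-transfer u with ℤP.<-cmp (K₁ u) (K₂ u)
    ... | tri< K₁<K₂ _ _ =
      ℤP.i≡j⇒i-j≡0 (sym (Mirror.surplus-confined u v K₁<K₂ (λ K₁<K₂ᵥ → ℤP.<⇒≢ K₁<K₂ᵥ K₁≡K₂)))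
    ... | tri≈ _ K₁≡K₂ᵤ _ = ℤP.i≡j⇒i-j≡0 (cong (λ a → send u a v) K₁≡K₂ᵤ)
    ... | tri> _ _ K₂<K₁ =
      ℤP.i≡j⇒i-j≡0 (surplus-confined u v K₂<K₁ (λ K₂<K₁ᵥ → ℤP.<⇒≢ K₂<K₁ᵥ (sym K₁≡K₂)))

module Rotors (G : RotorGraph) where
  open RotorGraph G

  θ^ : ℤ → Fin m → Fin m
  θ^ (+ k)     = iter θ k
  θ^ -[1+ k ]  = iter θ⁻ (suc k)

  θ^-suc : ∀ k a → θ^ (ℤ.suc k) a ≡ θ (θ^ k a)
  θ^-suc (+ k)          a = refl
  θ^-suc -[1+ zero ]    a = sym (θθ⁻ a)
  θ^-suc -[1+ suc k ]   a = sym (θθ⁻ _)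

  θ^-pred : ∀ k a → θ^ (ℤ.pred k) a ≡ θ⁻ (θ^ k a)
  θ^-pred k a = begin
      θ^ (ℤ.pred k) a                 ≡⟨ sym (θ⁻θ _) ⟩
      θ⁻ (θ (θ^ (ℤ.pred k) a))        ≡⟨ cong θ⁻ (sym (θ^-suc (ℤ.pred k) a)) ⟩
      θ⁻ (θ^ (ℤ.suc (ℤ.pred k)) a)    ≡⟨ cong (λ j → θ⁻ (θ^ j a)) (ℤP.suc-pred k) ⟩
      θ⁻ (θ^ k a)                     ∎
    where open ≡-Reasoning

  -- particles delivered to each vertex by k routings at a vertex with rotor a;
  -- for k < 0, minus those taken back by −k inverse routings
  sent : Fin m → ℤ → Fin n → ℤ
  sent a (+ zero)         v = 0ℤ
  sent a (+ suc k)        v = sent a (+ k) v + δ G (head (θ^ (+ k) a)) v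
  sent a -[1+ zero ]      v = - δ G (head (θ^ -[1+ zero ] a)) v
  sent a -[1+ suc k ]     v = sent a -[1+ k ] v - δ G (head (θ^ -[1+ suc k ] a)) v

  sent-suc : ∀ a k v → sent a (ℤ.suc k) v ≡ sent a k v + δ G (head (θ^ k a)) v
  sent-suc a (+ k)         v = refl
  sent-suc a -[1+ zero ]   v = sym (ℤP.+-inverseˡ (δ G (head (θ^ -[1+ zero ] a)) v))
  sent-suc a -[1+ suc k ]  v = sym (cancel _ _)
    where
    cancel : ∀ x d → x - d + d ≡ x
    cancel = solve-∀

  δ≥0 : ∀ w v → 0ℤ ≤ δ G w v
  δ≥0 w v = subst (_≤ δ G w v) (keepIf-zero ⌊ v ≟ w ⌋) (keepIf-mono-≤ ⌊ v ≟ w ⌋ (ℤ.+≤+ ℕ.z≤n))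

  sent-mono : ∀ a {i j} → i ≤ j → ∀ v → sent a i v ≤ sent a j v
  sent-mono a i≤j v = suc-increasing⇒mono (λ k → sent a k v)
    (λ k → subst (sent a k v ≤_) (sym (sent-suc a k v))
      (ℤP.≤-trans (ℤP.≤-reflexive (sym (ℤP.+-identityʳ _))) (ℤP.+-monoʳ-≤ (sent a k v) (δ≥0 _ v)))) i≤j

  ∑-sent : ∀ a k → sum (sent a k) ≡ k
  ∑-sent a = ℤ-induction (λ k → sum (sent a k) ≡ k) (sum-replicate-zero n)
    (λ k ∑≡k → trans (∑-sent-suc k) (cong (_+_ 1ℤ) ∑≡k))
    (λ k ∑≡1+k → ∙-cancelˡ 1ℤ _ _ (trans (sym (∑-sent-suc k)) ∑≡1+k))
    where
    ∑-sent-suc : ∀ k → sum (sent a (ℤ.suc k)) ≡ 1ℤ + sum (sent a k)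
    ∑-sent-suc k = begin
        sum (sent a (ℤ.suc k))                          ≡⟨ sum-cong-≗ (sent-suc a k) ⟩
        sum (λ v → sent a k v + δ G (head (θ^ k a)) v)  ≡⟨ ∑-distrib-+ (sent a k) _ ⟩
        sum (sent a k) + sum (δ G (head (θ^ k a)))      ≡⟨ cong (_+_ (sum (sent a k))) (∑-point (head (θ^ k a)) 1ℤ) ⟩
        sum (sent a k) + 1ℤ                             ≡⟨ ℤP.+-comm (sum (sent a k)) 1ℤ ⟩
        1ℤ + sum (sent a k)                             ∎
      where open ≡-Reasoning

  extend : ((u : Fin n) → V₀ u → ℤ) → Fin n → ℤ
  extend r u with T? (isNonSink u)
  ... | yes p = r u p
  ... | no _  = 0ℤ

  extend-nonSink : ∀ r {u} (p : V₀ u) → extend r u ≡ r u p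
  extend-nonSink r {u} p with T? (isNonSink u)
  ... | yes q  = cong (r u) (T-irrelevant q p)
  ... | no ¬p = contradiction p ¬p

  Settled : Config G → Set
  Settled c = ∀ u → V₀ u → proj₂ c u ≡ 0ℤ

  legalStep-preserves-≥0 : ∀ {c c'} → LegalStep G c c' → (∀ v → 0ℤ ≤ proj₂ c v) → ∀ v → 0ℤ ≤ proj₂ c' v
  legalStep-preserves-≥0 {ρ , σ} (w , p , 0<σw , refl) σ≥0 v =
    subst (0ℤ ≤_) (regroup (σ v) (δ G (head (ρ w p)) v) (δ G w v))
      (ℤP.+-mono-≤ σ-δ≥0 (δ≥0 (head (ρ w p)) v))
    where
    regroup : ∀ s d e → (s - e) + d ≡ (s + d) - e
    regroup = solve-∀
    σ-δ≥0 : 0ℤ ≤ σ v - δ G w v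
    σ-δ≥0 with v ≟ w
    ... | yes refl = ℤP.i≤j⇒0≤j-i (ℤP.i<j⇒suc[i]≤j 0<σw)
    ... | no _     = subst (0ℤ ≤_) (sym (ℤP.+-identityʳ (σ v))) (σ≥0 v)

  legal-preserves-≥0 : ∀ {c c'} → Star (LegalStep G) c c' → (∀ v → 0ℤ ≤ proj₂ c v) → ∀ v → 0ℤ ≤ proj₂ c' v
  legal-preserves-≥0 ε             σ≥0 = σ≥0
  legal-preserves-≥0 (step ◅ steps) σ≥0 = legal-preserves-≥0 steps (legalStep-preserves-≥0 step σ≥0)

  module Routed (ρ₀ : Rotor G) (σ₀ : Particles G) where

    -- a sink never fires; letting it keep its own particles makes its effect vanish
    send : Fin n → ℤ → Fin n → ℤ
    send u with T? (isNonSink u)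
    ... | yes p = sent (ρ₀ u p)
    ... | no _  = point u

    send-mono : ∀ u {a b} → a ≤ b → ∀ v → send u a v ≤ send u b v
    send-mono u a≤b v with T? (isNonSink u)
    ... | yes p = sent-mono (ρ₀ u p) a≤b v
    ... | no _  = keepIf-mono-≤ ⌊ v ≟ u ⌋ a≤b

    ∑-send : ∀ u a → sum (send u a) ≡ a
    ∑-send u a with T? (isNonSink u)
    ... | yes p = ∑-sent (ρ₀ u p) a
    ... | no _  = ∑-point u a

    send-nonSink : ∀ {u} (p : V₀ u) k v → send u k v ≡ sent (ρ₀ u p) k v
    send-nonSink {u} p k v with T? (isNonSink u)
    ... | yes q  = cong (λ q → sent (ρ₀ u q) k v) (T-irrelevant q p)
    ... | no ¬p = contradiction p ¬p

    send-zero : ∀ u v → send u 0ℤ v ≡ 0ℤ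
    send-zero u v with T? (isNonSink u)
    ... | yes p = refl
    ... | no _  = keepIf-zero ⌊ v ≟ u ⌋

    open FlowConservation send send-mono ∑-send

    effect-suc : ∀ {w} (p : V₀ w) k v →
      effect w (ℤ.suc k) v - effect w k v ≡ δ G (head (θ^ k (ρ₀ w p))) v - δ G w v
    effect-suc {w} p k v = begin
        effect w (ℤ.suc k) v - effect w k v
      ≡⟨ cong₂ (λ s s' → (s - point w (1ℤ + k) v) - (s' - point w k v))
               (send-nonSink p (ℤ.suc k) v) (send-nonSink p k v) ⟩
        (sent a (ℤ.suc k) v - point w (1ℤ + k) v) - (sent a k v - point w k v)
      ≡⟨ cong₂ (λ s q → (s - q) - (sent a k v - point w k v)) (sent-suc a k v) (keepIf-+ ⌊ v ≟ w ⌋ 1ℤ k) ⟩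
        ((sent a k v + δ G (head (θ^ k a)) v) - (δ G w v + point w k v)) - (sent a k v - point w k v)
      ≡⟨ regroup (sent a k v) (δ G (head (θ^ k a)) v) (δ G w v) (point w k v) ⟩
        δ G (head (θ^ k a)) v - δ G w v
      ∎
      where
      open ≡-Reasoning
      a = ρ₀ w p
      regroup : ∀ s d e q → ((s + d) - (e + q)) - (s - q) ≡ d - e
      regroup = solve-∀

    effect-pred : ∀ {w} (p : V₀ w) k v →
      effect w (ℤ.pred k) v - effect w k v ≡ δ G w v - δ G (head (θ⁻ (θ^ k (ρ₀ w p)))) v
    effect-pred {w} p k v = begin
        effect w (ℤ.pred k) v - effect w k v
      ≡⟨ sym (⁻¹-anti-homo‿- (effect w k v) (effect w (ℤ.pred k) v)) ⟩
        - (effect w k v - effect w (ℤ.pred k) v)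
      ≡⟨ cong (λ j → - (effect w j v - effect w (ℤ.pred k) v)) (sym (ℤP.suc-pred k)) ⟩
        - (effect w (ℤ.suc (ℤ.pred k)) v - effect w (ℤ.pred k) v)
      ≡⟨ cong -_ (effect-suc p (ℤ.pred k) v) ⟩
        - (δ G (head (θ^ (ℤ.pred k) (ρ₀ w p))) v - δ G w v)
      ≡⟨ ⁻¹-anti-homo‿- _ (δ G w v) ⟩
        δ G w v - δ G (head (θ^ (ℤ.pred k) (ρ₀ w p))) v
      ≡⟨ cong (λ a → δ G w v - δ G (head a) v) (θ^-pred k (ρ₀ w p)) ⟩
        δ G w v - δ G (head (θ⁻ (θ^ k (ρ₀ w p)))) v
      ∎
      where open ≡-Reasoning

    RoutedBy : (Fin n → ℤ) → Config G → Set
    RoutedBy K c = (∀ u p → proj₁ c u p ≡ θ^ (K u) (ρ₀ u p))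
                 × (∀ v → proj₂ c v ≡ σ₀ v + netFlow K v)

    RoutedBy-start : RoutedBy (λ _ → 0ℤ) (ρ₀ , σ₀)
    RoutedBy-start = (λ u p → refl) , λ v → sym (begin
        σ₀ v + netFlow (λ _ → 0ℤ) v  ≡⟨ cong (_+_ (σ₀ v)) (trans (sum-cong-≗ no-effect) (sum-replicate-zero n)) ⟩
        σ₀ v + 0ℤ                    ≡⟨ ℤP.+-identityʳ (σ₀ v) ⟩
        σ₀ v                         ∎)
      where
      open ≡-Reasoning
      no-effect : ∀ {v} u → effect u 0ℤ v ≡ 0ℤ
      no-effect {v} u = cong₂ _-_ (send-zero u v) (keepIf-zero ⌊ v ≟ u ⌋)

    netFlow-cong : ∀ {K K'} → (∀ u → V₀ u → K u ≡ K' u) → ∀ v → netFlow K v ≡ netFlow K' v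
    netFlow-cong {K} {K'} agree v = sum-cong-≗ same-effect
      where
      same-effect : ∀ u → effect u (K u) v ≡ effect u (K' u) v
      same-effect u with T? (isNonSink u)
      ... | yes p = cong (λ k → sent (ρ₀ u p) k v - point u k v) (agree u p)
      ... | no _  = trans (ℤP.+-inverseʳ (point u (K u) v)) (sym (ℤP.+-inverseʳ (point u (K' u) v)))

    RoutedBy-cong : ∀ {K K' c} → (∀ u → V₀ u → K u ≡ K' u) → RoutedBy K c → RoutedBy K' c
    RoutedBy-cong agree (rotors , particles) =
      (λ u p → trans (rotors u p) (cong (λ k → θ^ k (ρ₀ u p)) (agree u p))) ,
      (λ v → trans (particles v) (cong (_+_ (σ₀ v)) (netFlow-cong agree v)))

    RoutedBy-resp : ∀ {K c c'} → ConfigEq G c c' → RoutedBy K c → RoutedBy K c'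
    RoutedBy-resp (same-rotors , same-particles) (rotors , particles) =
      (λ u p → trans (sym (same-rotors u p)) (rotors u p)) ,
      (λ v → trans (sym (same-particles v)) (particles v))

    RoutedBy-functional : ∀ {K c c'} → RoutedBy K c → RoutedBy K c' → ConfigEq G c c'
    RoutedBy-functional (rotors , particles) (rotors' , particles') =
      (λ u p → trans (rotors u p) (sym (rotors' u p))) ,
      (λ v → trans (particles v) (sym (particles' v)))

    RoutedBy-fire : ∀ {K ρ σ σ' a} w (p : V₀ w) d → RoutedBy K (ρ , σ) →
      a ≡ θ^ (d + K w) (ρ₀ w p) →
      (∀ v → σ' v ≡ σ v + (effect w (d + K w) v - effect w (K w) v)) →
      RoutedBy (addAt w d K) (updRotor G ρ w a , σ')
    RoutedBy-fire {K} {ρ} {σ} {σ'} {a} w p d (rotors , particles) a≡ σ'≡ = new-rotors , new-particles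
      where
      open ≡-Reasoning
      new-rotors : ∀ u q → updRotor G ρ w a u q ≡ θ^ (addAt w d K u) (ρ₀ u q)
      new-rotors u q with u ≟ w
      ... | yes refl = trans a≡ (cong (λ q → θ^ (d + K u) (ρ₀ u q)) (T-irrelevant p q))
      ... | no _     = trans (rotors u q) (cong (λ k → θ^ k (ρ₀ u q)) (sym (ℤP.+-identityˡ (K u))))
      new-particles : ∀ v → σ' v ≡ σ₀ v + netFlow (addAt w d K) v
      new-particles v = begin
          σ' v
        ≡⟨ σ'≡ v ⟩
          σ v + (effect w (d + K w) v - effect w (K w) v)
        ≡⟨ cong (_+ (effect w (d + K w) v - effect w (K w) v)) (particles v) ⟩
          σ₀ v + netFlow K v + (effect w (d + K w) v - effect w (K w) v)
        ≡⟨ ℤP.+-assoc (σ₀ v) (netFlow K v) _ ⟩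
          σ₀ v + (netFlow K v + (effect w (d + K w) v - effect w (K w) v))
        ≡⟨ cong (λ k → σ₀ v + (netFlow K v + (effect w k v - effect w (K w) v)))
                (sym (cong (_+ K w) (point-at w d))) ⟩
          σ₀ v + (netFlow K v + (effect w (addAt w d K w) v - effect w (K w) v))
        ≡⟨ cong (_+_ (σ₀ v)) (sym (∑-update w (λ u u≢w → cong (λ k → effect u k v) (off u≢w)))) ⟩
          σ₀ v + netFlow (addAt w d K) v
        ∎
        where
        off : ∀ {u} → u ≢ w → addAt w d K u ≡ K u
        off {u} u≢w = trans (cong (_+ K u) (point-off d u≢w)) (ℤP.+-identityˡ (K u))

    RoutedBy-routing⁺ : ∀ {K c} w (p : V₀ w) → RoutedBy K c → RoutedBy (addAt w 1ℤ K) (routing⁺ G w p c)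
    RoutedBy-routing⁺ {K} {ρ , σ} w p R@(rotors , _) = RoutedBy-fire w p 1ℤ R
      (trans (cong θ (rotors w p)) (sym (θ^-suc (K w) (ρ₀ w p))))
      (λ v → trans (ℤP.+-assoc (σ v) _ _) (trans
        (cong (λ a → σ v + (δ G (head a) v - δ G w v)) (rotors w p))
        (cong (_+_ (σ v)) (sym (effect-suc p (K w) v)))))

    RoutedBy-routing⁻ : ∀ {K c} w (p : V₀ w) → RoutedBy K c → RoutedBy (addAt w -1ℤ K) (routing⁻ G w p c)
    RoutedBy-routing⁻ {K} {ρ , σ} w p R@(rotors , _) = RoutedBy-fire w p -1ℤ R
      (trans (cong θ⁻ (rotors w p)) (sym (θ^-pred (K w) (ρ₀ w p))))
      (λ v → trans (regroup (σ v) _ _) (trans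
        (cong (λ a → σ v + (δ G w v - δ G (head (θ⁻ a)) v)) (rotors w p))
        (cong (_+_ (σ v)) (sym (effect-pred p (K w) v)))))
      where
      regroup : ∀ s d e → (s - d) + e ≡ s + (e - d)
      regroup = solve-∀

    RoutedBy-iter : ∀ {f : Config G → Config G} w d →
      (∀ {K c} → RoutedBy K c → RoutedBy (addAt w d K) (f c)) →
      ∀ k {K c} → RoutedBy K c → RoutedBy (addAt w (+ k * d) K) (iter f k c)
    RoutedBy-iter w d step zero    {K} R = RoutedBy-cong (λ u _ → sym (addAt-zero w K u)) R
    RoutedBy-iter w d step (suc k) {K} R = RoutedBy-cong (λ u _ → trans (addAt-addAt w d (+ k * d) K u)
        (cong (λ x → addAt w x K u) (sym (ℤP.suc-* (+ k) d))))
      (step (RoutedBy-iter w d step k R))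

    RoutedBy-routingPow : ∀ {K c} w (p : V₀ w) j → RoutedBy K c → RoutedBy (addAt w j K) (routingPow G w p j c)
    RoutedBy-routingPow {K} w p (+ k) R =
      RoutedBy-cong (λ u _ → cong (λ x → addAt w x K u) (ℤP.*-identityʳ (+ k)))
        (RoutedBy-iter w 1ℤ (RoutedBy-routing⁺ w p) k R)
    RoutedBy-routingPow {K} w p -[1+ k ] R =
      RoutedBy-cong (λ u _ → cong (λ x → addAt w x K u) (*-1 (+ suc k)))
        (RoutedBy-iter w -1ℤ (RoutedBy-routing⁻ w p) (suc k) R)
      where
      *-1 : ∀ x → x * -1ℤ ≡ - x
      *-1 = solve-∀

    RoutedBy-routingStep : ∀ {K c} r w → RoutedBy K c → RoutedBy (addAt w (extend r w) K) (routingStep G r w c)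
    RoutedBy-routingStep {K} r w R with T? (isNonSink w)
    ... | yes p = RoutedBy-routingPow w p (r w p) R
    ... | no _  = RoutedBy-cong (λ u _ → sym (addAt-zero w K u)) R

    RoutedBy-foldr : ∀ {K c} r {j} (g : Fin j → Fin n) → RoutedBy K c →
      RoutedBy (λ u → sum (λ i → point (g i) (extend r (g i)) u) + K u) (foldr (routingStep G r) c (tabulate g))
    RoutedBy-foldr {K} r {zero}  g R = RoutedBy-cong (λ u _ → sym (ℤP.+-identityˡ (K u))) R
    RoutedBy-foldr {K} r {suc j} g R =
      RoutedBy-cong (λ u _ → sym (ℤP.+-assoc (placed Fin.zero u) (sum (λ i → placed (Fin.suc i) u)) (K u)))
        (RoutedBy-routingStep r (g Fin.zero) (RoutedBy-foldr r (g ∘ Fin.suc) R))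
      where
      placed : Fin (suc j) → Fin n → ℤ
      placed i = point (g i) (extend r (g i))

    RoutedBy-routing : ∀ {K c} r → RoutedBy K c → RoutedBy (λ u → extend r u + K u) (routing G r c)
    RoutedBy-routing {K} r R =
      RoutedBy-cong (λ u _ → cong (_+ K u) (∑-point-diag (extend r) u)) (RoutedBy-foldr r id R)

    RoutedBy-legal : ∀ {K c c'} → RoutedBy K c → Star (LegalStep G) c c' → ∃[ K' ] RoutedBy K' c'
    RoutedBy-legal R ε                              = _ , R
    RoutedBy-legal R ((w , p , _ , refl) ◅ steps) = RoutedBy-legal (RoutedBy-routing⁺ w p R) steps

    RoutedBy⇒∼ : ∀ {K K' c c'} → RoutedBy K c → RoutedBy K' c' → _∼_ G c c'
    RoutedBy⇒∼ {K} {K'} R R' = r , RoutedBy-functional (RoutedBy-cong difference (RoutedBy-routing r R)) R'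
      where
      r : (u : Fin n) → V₀ u → ℤ
      r u _ = K' u - K u
      cancel : ∀ x y → (y - x) + x ≡ y
      cancel = solve-∀
      difference : ∀ u → V₀ u → extend r u + K u ≡ K' u
      difference u p = trans (cong (_+ K u) (extend-nonSink r p)) (cancel (K u) (K' u))

    settled-unique : ∀ {K K' c c'} → RoutedBy K c → RoutedBy K' c' → Settled c → Settled c' →
      ∀ v → proj₂ c v ≡ proj₂ c' v
    settled-unique {K} {K'} R R' settled settled' v =
      trans (proj₂ R̂ v) (trans (cong (_+_ (σ₀ v)) (netFlow-unique K̂ K̂' differ v)) (sym (proj₂ R̂' v)))
      where
      -- counts at sinks are irrelevant; zeroing them leaves only non-sinks where K̂, K̂' may differ
      K̂ K̂' : Fin n → ℤ
      K̂  = extend (λ u _ → K u)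
      K̂' = extend (λ u _ → K' u)
      R̂ : RoutedBy K̂ _
      R̂ = RoutedBy-cong (λ u p → sym (extend-nonSink (λ u _ → K u) p)) R
      R̂' : RoutedBy K̂' _
      R̂' = RoutedBy-cong (λ u p → sym (extend-nonSink (λ u _ → K' u) p)) R'
      differ : ∀ w → K̂ w ≢ K̂' w → netFlow K̂ w ≡ netFlow K̂' w
      differ w K̂≢K̂' with T? (isNonSink w)
      ... | yes p = ∙-cancelˡ (σ₀ w) _ _
          (trans (sym (proj₂ R̂ w)) (trans (settled w p) (trans (sym (settled' w p)) (proj₂ R̂' w))))
      ... | no _  = contradiction refl K̂≢K̂'

corollary1 : (G : RotorGraph) →
    (ρ : Rotor G) (σ : Particles G) → ValidRotor G ρ →
    (∀ v → 0ℤ ≤ σ v) →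
    (ρ' : Rotor G) (σ' : Particles G) → IsRoutingInfL G (ρ , σ) (ρ' , σ') →
    (ρ₁ : Rotor G) (σ₁ : Particles G) → _∈routing∞_ G (ρ₁ , σ₁) (ρ , σ) →
    (∀ v → σ₁ v ≡ σ' v) × _∼ᵣ_ G ρ' ρ₁
corollary1 G ρ σ _ σ≥0 ρ' σ' (legal , stable) ρ₁ σ₁ ((r , routed) , settled₁) =
  σ₁≗σ' , σ' , RoutedBy⇒∼ Rₗ (RoutedBy-resp ((λ _ _ → refl) , σ₁≗σ') R₁)
  where
  open Rotors G
  open Routed ρ σ
  Rₗ : RoutedBy _ (ρ' , σ')
  Rₗ = proj₂ (RoutedBy-legal RoutedBy-start legal)
  R₁ : RoutedBy _ (ρ₁ , σ₁)
  R₁ = RoutedBy-resp routed (RoutedBy-routing r RoutedBy-start)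
  settled' : Settled (ρ' , σ')
  settled' u p = ℤP.≤-antisym (stable u p) (legal-preserves-≥0 legal σ≥0 u)
  σ₁≗σ' : ∀ v → σ₁ v ≡ σ' v
  σ₁≗σ' = settled-unique R₁ Rₗ settled₁ settled'
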